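{- For every integer $n$, the graph $\ddot{U}_n$ has no $\mathit{XX}$ linkage minor with respect to $L_n$.
   Context: For an integer $n$, $\ddot{U}_n$ is the graph with vertex set $\{v_1,\dots,v_n\}\cup\{u_1,\dots,u_n\}$ and edge set $\{v_iv_{i+1}: 1\le i\le n-1\}\cup\{u_iu_{i+1}:1\le i\le n-1\}\cup\{u_iv_i:1\le i\le n\}\cup\{u_iv_{n+1-i}:1\le i\le n\}$; $L_n$ is the linkage (subgraph whose components are paths) of $\ddot{U}_n$ consisting of the edges $v_iv_{i+1}$ and $u_iu_{i+1}$ for $1\le i\le n-1$, i.e. the two paths $v_1\cdots v_n$ and $u_1\cdots u_n$. Edges of $L_n$ are path edges, the other edges are rung edges. A linkage minor of $\ddot{U}_n$ with respect to $L_n$ is a minor $H$ such that every path edge not in $H$ has been contracted and every rung edge not in $H$ has been deleted. An $\mathit{XX}$ linkage minor is a linkage minor isomorphic to $K_{2,4}$ in which the four terminal (end) vertices $v_1,v_n,u_1,u_n$ of the two paths are mapped to the four degree-2 vertices of $K_{2,4}$. -}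

module Defs where

open import Data.Nat using (ℕ; zero; suc; _+_; _≡ᵇ_)
open import Data.Fin using (Fin; toℕ; fromℕ; _↑ˡ_; _↑ʳ_)
import Data.Fin
open import Data.Bool using (Bool; true; false; T; _∨_)
open import Data.Empty using (⊥)
open import Data.Product using (Σ; ∃; ∃₂; _×_; _,_; proj₁; proj₂)
open import Data.Sum using (_⊎_)
open import Relation.Nullary using (¬_)
open import Relation.Binary.PropositionalEquality using (_≡_)
open import Relation.Binary.Construct.Closure.Equivalence using (EqClosure)

-- The graph Ü_n (vertices and paths are 0-indexed: index i here is
-- index i+1 in the paper).

data Side : Set where
  vSide uSide : Side

-- (vSide , i) is v_{i+1}, (uSide , i) is u_{i+1}.
Vertex : ℕ → Set
Vertex n = Side × Fin n

-- Edges of Ü_n, as a *set* (each edge has exactly one representative;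
-- the T-proofs are proof-irrelevant since T b is ⊤ or ⊥).
data GEdge (n : ℕ) : Set where
  pathE : (s : Side) (i j : Fin n) → T (toℕ j ≡ᵇ suc (toℕ i)) → GEdge n
  -- rung edge u_{i} v_{j} where j = i or (1-indexed) j = n+1-i,
  -- i.e. 0-indexed i + j + 1 = n
  rungE : (i j : Fin n) →
          T ((toℕ j ≡ᵇ toℕ i) ∨ (toℕ i + toℕ j + 1 ≡ᵇ n)) → GEdge n

ends : {n : ℕ} → GEdge n → Vertex n × Vertex n
ends (pathE s i j _) = (s , i) , (s , j)
ends (rungE i j _)   = (uSide , i) , (vSide , j)

-- The linkage L_n: its edges are the path edges.
isPathEdge : {n : ℕ} → GEdge n → Bool
isPathEdge (pathE _ _ _ _) = true
isPathEdge (rungE _ _ _)   = false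

-- K_{2,4}: vertex set Fin 6; vertices 0,1 form the side of size 2
-- (degree 4), vertices 2..5 form the side of size 4 (degree 2).
-- Edges of K_{2,4} are indexed by Fin 2 × Fin 4.

bigV : Fin 2 → Fin 6
bigV a = a ↑ˡ 4

smallV : Fin 4 → Fin 6
smallV b = 2 ↑ʳ b

K24Edge : Set
K24Edge = Fin 2 × Fin 4

K24Incident : Fin 6 → Fin 6 → K24Edge → Set
K24Incident x y (a , b) =
  (x ≡ bigV a × y ≡ smallV b) ⊎ (x ≡ smallV b × y ≡ bigV a)

K24Deg2 : Fin 6 → Set
K24Deg2 x = ∃ λ b → x ≡ smallV b

-- Linkage minors.  `keep e = true` means e is an edge of H; a path edge
-- with `keep e = false` is contracted, a rung edge with `keep e = false`
-- is deleted.  The vertices of H are the classes of the equivalence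
-- relation generated by the contracted path edges.

ContractStep : {n : ℕ} → (GEdge n → Bool) → Vertex n → Vertex n → Set
ContractStep {n} keep x y =
  Σ (GEdge n) λ e → isPathEdge e ≡ true × keep e ≡ false × ends e ≡ (x , y)

SameHVertex : {n : ℕ} → (GEdge n → Bool) → Vertex n → Vertex n → Set
SameHVertex keep = EqClosure (ContractStep keep)

-- The terminals v_1, v_n, u_1, u_n are sent to four distinct degree-2
-- vertices of K_{2,4}.  (For n = 0 there are no terminals.)
XXTerminals : (n : ℕ) → (Vertex n → Fin 6) → Set
XXTerminals zero    f = ⊥
XXTerminals (suc m) f =
  K24Deg2 t1 × K24Deg2 t2 × K24Deg2 t3 × K24Deg2 t4 ×
  ¬ t1 ≡ t2 × ¬ t1 ≡ t3 × ¬ t1 ≡ t4 ×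
  ¬ t2 ≡ t3 × ¬ t2 ≡ t4 × ¬ t3 ≡ t4
  where
  t1 = f (vSide , Data.Fin.zero)
  t2 = f (vSide , fromℕ m)
  t3 = f (uSide , Data.Fin.zero)
  t4 = f (uSide , fromℕ m)

-- An XX linkage minor of Ü_n w.r.t. L_n: a linkage minor H together with
-- an isomorphism H ≅ K_{2,4} (a bijection `f` on vertices, given as a map
-- on Vertex n constant exactly on the H-vertex classes, and a bijection
-- `φ` on edges preserving incidence), mapping terminals as required.
record XXLinkageMinor (n : ℕ) : Set where
  field
    keep    : GEdge n → Bool
    f       : Vertex n → Fin 6
    φ       : (e : GEdge n) → T (keep e) → K24Edge
    f-class : ∀ x y → SameHVertex keep x y → f x ≡ f y
    class-f : ∀ x y → f x ≡ f y → SameHVertex keep x y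
    f-surj  : ∀ c → ∃ λ x → f x ≡ c
    φ-inc   : ∀ e (k : T (keep e)) →
              K24Incident (f (proj₁ (ends e))) (f (proj₂ (ends e))) (φ e k)
    φ-inj   : ∀ e e' (k : T (keep e)) (k' : T (keep e')) →
              φ e k ≡ φ e' k' → e ≡ e'
    φ-surj  : ∀ c → ∃₂ λ e (k : T (keep e)) → φ e k ≡ c
    terminals : XXTerminals n f

module Submission where

-- Write n = m + 1 and number the vertices of both paths 0, …, m.  An XX
-- linkage minor is given by a colouring f of the vertices by K_{2,4}, whose
-- colour classes are the classes of contracted path edges.
--   * Every colour class is an interval of one path: contractions never
--     change sides (`sameSide`), and a kept path edge separates the two parts
--     of its path (`keptEdge-separates`), which gives `interval`.
--   * Both paths have distinct terminal colours, so each has a kept edge,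
--     whose image in K_{2,4} has a degree-4 end: each path carries a big
--     colour (`bigColourOn`), Y on the u-path and X on the v-path.
--   * A K_{2,4}-edge between a u-colour and a v-colour is the image of a rung
--     (`rungBetween`), and rungs preserve the `depth` min(i, m - i).
--   * Realising Y–[v₁], Y–[vₙ], [u₁]–X, [uₙ]–X by rungs ([x] the colour of
--     x, a degree-2 vertex for each terminal x), the rung ends
--     coloured big lie strictly between the ends coloured by the terminals
--     (`bigBetweenTerminals`); depth being unimodal, the minimal depths of
--     these ends would strictly increase around a cycle (`nestedRungs-impossible`).

open import Defs
open import Data.Nat using (ℕ; zero; suc; _+_; _∸_; _⊓_; _≤_; _<_; z≤n; s≤s⁻¹; _≤?_; _≡ᵇ_)
open import Data.Nat.Properties
  using ( ≤-refl; ≤-trans; <⇒≤; ≤-<-trans; <-≤-trans; <-irrefl; ≤∧≢⇒<; ≰⇒>; n<1+n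
        ; m<n⇒m<1+n; m≤n⇒m<n∨m≡n; suc-injective; +-comm; ≡ᵇ⇒≡; ≡⇒≡ᵇ
        ; ⊓-comm; ⊓-glb; m⊓n≤m; m⊓n≤n; ∸-monoʳ-<; m+n∸m≡n; m+n∸n≡m; module ≤-Reasoning)
open import Data.Nat.DivMod using (_mod_; m≤n⇒m%n≡m)
open import Data.Fin using (Fin; toℕ; fromℕ)
import Data.Fin as Fin
open import Data.Fin.Properties using (_≟_; toℕ-injective; toℕ-fromℕ; toℕ-fromℕ<; toℕ≤pred[n])
open import Data.Bool using (Bool; true; false; T; _∨_)
open import Data.Bool.Properties using (T-irrelevant; T-∨)
open import Data.Unit using (tt)
open import Data.Empty using (⊥; ⊥-elim)
open import Data.Product using (Σ; ∃; ∃₂; _×_; _,_; proj₁; proj₂)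
open import Data.Sum using (_⊎_; inj₁; inj₂)
open import Function using (_∘_)
open import Function.Bundles using (Equivalence)
open import Relation.Nullary using (¬_; yes; no; does)
open import Relation.Nullary.Decidable using (dec-true; dec-false)
open import Relation.Binary.Definitions using (DecidableEquality)
open import Relation.Binary.PropositionalEquality
open import Relation.Binary.Construct.Closure.Equivalence using (gfold; return)

depth : ℕ → ℕ → ℕ
depth N t = t ⊓ (N ∸ t)

depth-mirror : ∀ {N i j} → i + j ≡ N → depth N i ≡ depth N j
depth-mirror {i = i} {j} refl = begin
  i ⊓ (i + j ∸ i)  ≡⟨ cong (i ⊓_) (m+n∸m≡n i j) ⟩
  i ⊓ j            ≡⟨ ⊓-comm i j ⟩
  j ⊓ i            ≡⟨ cong (j ⊓_) (m+n∸n≡m i j) ⟨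
  j ⊓ (i + j ∸ j)  ∎
  where open ≡-Reasoning

rung-depth : ∀ {n} (i j : Fin (suc n)) →
             T ((toℕ j ≡ᵇ toℕ i) ∨ (toℕ i + toℕ j + 1 ≡ᵇ suc n)) →
             depth n (toℕ i) ≡ depth n (toℕ j)
rung-depth {n} i j r with Equivalence.to T-∨ r
... | inj₁ j≡i = cong (depth n) (sym (≡ᵇ⇒≡ _ _ j≡i))
... | inj₂ i+j+1≡n+1 =
  depth-mirror (suc-injective (trans (+-comm 1 (toℕ i + toℕ j)) (≡ᵇ⇒≡ _ _ i+j+1≡n+1)))

depth-inside : ∀ {N a t b} → a < t → t < b → b ≤ N → depth N a ⊓ depth N b < depth N t
depth-inside {N} {a} {b = b} a<t t<b b≤N = ⊓-glb
  (≤-<-trans (≤-trans (m⊓n≤m _ _) (m⊓n≤m a (N ∸ a))) a<t)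
  (≤-<-trans (≤-trans (m⊓n≤n _ _) (m⊓n≤n b (N ∸ b))) (∸-monoʳ-< t<b b≤N))

depth-inside₂ : ∀ {N a t t′ b} → a < t × t < b → a < t′ × t′ < b → b ≤ N →
                depth N a ⊓ depth N b < depth N t ⊓ depth N t′
depth-inside₂ (a<t , t<b) (a<t′ , t′<b) b≤N =
  ⊓-glb (depth-inside a<t t<b b≤N) (depth-inside a<t′ t′<b b≤N)

-- Four pairs (i_k, j_k) of equal depth cannot nest so that i₁, i₂ lie
-- strictly between i₃, i₄ while j₃, j₄ lie strictly between j₁, j₂: the
-- minimal depth of the outer ends would be smaller than itself.
nestedRungs-impossible : ∀ {N i₁ i₂ i₃ i₄ j₁ j₂ j₃ j₄} →
  depth N i₁ ≡ depth N j₁ → depth N i₂ ≡ depth N j₂ →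
  depth N i₃ ≡ depth N j₃ → depth N i₄ ≡ depth N j₄ →
  i₃ < i₁ × i₁ < i₄ → i₃ < i₂ × i₂ < i₄ → i₄ ≤ N →
  j₁ < j₃ × j₃ < j₂ → j₁ < j₄ × j₄ < j₂ → j₂ ≤ N → ⊥
nestedRungs-impossible {N} {i₁} {i₂} {i₃} {i₄} {j₁} {j₂} {j₃} {j₄}
  d₁ d₂ d₃ d₄ i₁-inside i₂-inside i₄≤N j₃-inside j₄-inside j₂≤N =
  <-irrefl refl (begin-strict
    depth N i₃ ⊓ depth N i₄  <⟨ depth-inside₂ i₁-inside i₂-inside i₄≤N ⟩
    depth N i₁ ⊓ depth N i₂  ≡⟨ cong₂ _⊓_ d₁ d₂ ⟩
    depth N j₁ ⊓ depth N j₂  <⟨ depth-inside₂ j₃-inside j₄-inside j₂≤N ⟩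
    depth N j₃ ⊓ depth N j₄  ≡⟨ cong₂ _⊓_ d₃ d₄ ⟨
    depth N i₃ ⊓ depth N i₄  ∎)
  where open ≤-Reasoning

changeStep : {A : Set} → DecidableEquality A → (h : ℕ → A) → ∀ {a b} →
             a ≤ b → h a ≢ h b → ∃ λ k → a ≤ k × k < b × h k ≢ h (suc k)
changeStep _≟ᴬ_ h {b = zero} z≤n ha≢hb = ⊥-elim (ha≢hb refl)
changeStep _≟ᴬ_ h {b = suc b} a≤1+b ha≢hb with m≤n⇒m<n∨m≡n a≤1+b
... | inj₂ refl = ⊥-elim (ha≢hb refl)
... | inj₁ a<1+b with h b ≟ᴬ h (suc b)
...   | no hb≢hb+1 = b , s≤s⁻¹ a<1+b , n<1+n b , hb≢hb+1
...   | yes hb≡hb+1 with changeStep _≟ᴬ_ h (s≤s⁻¹ a<1+b) (λ ha≡hb → ha≢hb (trans ha≡hb hb≡hb+1))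
...     | k , a≤k , k<b , step = k , a≤k , m<n⇒m<1+n k<b , step

≤?-step : ∀ {i k} → i ≢ k → does (i ≤? k) ≡ does (suc i ≤? k)
≤?-step {i} {k} i≢k with i ≤? k
... | yes i≤k = trans (dec-true (i ≤? k) i≤k) (sym (dec-true (suc i ≤? k) (≤∧≢⇒< i≤k i≢k)))
... | no  i≰k = trans (dec-false (i ≤? k) i≰k) (sym (dec-false (suc i ≤? k) (i≰k ∘ <⇒≤)))

≢false⇒T : ∀ {b} → b ≢ false → T b
≢false⇒T {true}  _       = tt
≢false⇒T {false} b≢false = b≢false refl

K24-bigEnd : ∀ {x y e} → K24Incident x y e →
             (∃ λ a → x ≡ bigV a) ⊎ (∃ λ a → y ≡ bigV a)
K24-bigEnd {e = a , _} (inj₁ (x≡a , _)) = inj₁ (a , x≡a)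
K24-bigEnd {e = a , _} (inj₂ (_ , y≡a)) = inj₂ (a , y≡a)

K24-ends : ∀ {x y x′ y′ e} → K24Incident x y e → K24Incident x′ y′ e →
           (x ≡ x′ × y ≡ y′) ⊎ (x ≡ y′ × y ≡ x′)
K24-ends {e = _ , _} (inj₁ (refl , refl)) (inj₁ (refl , refl)) = inj₁ (refl , refl)
K24-ends {e = _ , _} (inj₁ (refl , refl)) (inj₂ (refl , refl)) = inj₂ (refl , refl)
K24-ends {e = _ , _} (inj₂ (refl , refl)) (inj₁ (refl , refl)) = inj₂ (refl , refl)
K24-ends {e = _ , _} (inj₂ (refl , refl)) (inj₂ (refl , refl)) = inj₁ (refl , refl)

big≢small : ∀ {x a b} → x ≡ bigV a → x ≢ smallV b
big≢small {a = Fin.zero} refl ()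
big≢small {a = Fin.suc Fin.zero} refl ()

module XXMinor (m : ℕ) (M : XXLinkageMinor (suc m)) where
  open XXLinkageMinor M

  -- Vertices of the same colour lie on the same path, since contracted
  -- edges are path edges.
  sameSide : ∀ {x y} → f x ≡ f y → proj₁ x ≡ proj₁ y
  sameSide fx≡fy = gfold isEquivalence proj₁ contraction-keeps-side (class-f _ _ fx≡fy)
    where
    contraction-keeps-side : ∀ {x y} → ContractStep keep x y → proj₁ x ≡ proj₁ y
    contraction-keeps-side (pathE _ _ _ _ , _ , _ , refl) = refl
    contraction-keeps-side (rungE _ _ _ , () , _ , _)

  -- Position t of a path, as an index (only used for t ≤ m).
  pos : ℕ → Fin (suc m)
  pos t = t mod suc m

  toℕ-pos : ∀ {t} → t ≤ m → toℕ (pos t) ≡ t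
  toℕ-pos t≤m = trans (toℕ-fromℕ< _) (m≤n⇒m%n≡m t≤m)

  pos-toℕ : (i : Fin (suc m)) → pos (toℕ i) ≡ i
  pos-toℕ i = toℕ-injective (toℕ-pos (toℕ≤pred[n] i))

  pos-last : pos m ≡ fromℕ m
  pos-last = toℕ-injective (trans (toℕ-pos ≤-refl) (sym (toℕ-fromℕ m)))

  F : Side → ℕ → Fin 6
  F s t = f (s , pos t)

  edgeAt : Side → (k : ℕ) → k < m → GEdge (suc m)
  edgeAt s k k<m = pathE s (pos k) (pos (suc k)) (≡⇒≡ᵇ _ _ (begin
    toℕ (pos (suc k))  ≡⟨ toℕ-pos k<m ⟩
    suc k              ≡⟨ cong suc (toℕ-pos (<⇒≤ k<m)) ⟨
    suc (toℕ (pos k))  ∎))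
    where open ≡-Reasoning

  KeptAt : Side → ℕ → Set
  KeptAt s k = Σ (k < m) λ k<m → T (keep (edgeAt s k k<m))

  edgeAt-kept : ∀ {s k} → k < m → F s k ≢ F s (suc k) → KeptAt s k
  edgeAt-kept {s} {k} k<m Fk≢Fk+1 = k<m , ≢false⇒T notContracted
    where
    notContracted : keep (edgeAt s k k<m) ≢ false
    notContracted contracted = Fk≢Fk+1 (f-class _ _ (return (edgeAt s k k<m , refl , contracted , refl)))

  index-pos : ∀ {i t} → toℕ i ≡ t → i ≡ pos t
  index-pos {i} refl = sym (pos-toℕ i)

  pathE-cong : ∀ {s} {i i′ j j′ : Fin (suc m)} {q q′} → i ≡ i′ → j ≡ j′ → pathE s i j q ≡ pathE s i′ j′ q′
  pathE-cong refl refl = cong (pathE _ _ _) (T-irrelevant _ _)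

  pathE-at : ∀ {s} {i j : Fin (suc m)} {k} {k<m : k < m} (q : T (toℕ j ≡ᵇ suc (toℕ i))) →
             toℕ i ≡ k → pathE s i j q ≡ edgeAt s k k<m
  pathE-at {j = j} q i≡k = pathE-cong (index-pos i≡k) (index-pos (trans (≡ᵇ⇒≡ (toℕ j) _ q) (cong suc i≡k)))

  leftOf : Side → ℕ → Vertex (suc m) → Bool
  leftOf vSide k (vSide , i) = does (toℕ i ≤? k)
  leftOf uSide k (uSide , i) = does (toℕ i ≤? k)
  leftOf vSide k (uSide , _) = false
  leftOf uSide k (vSide , _) = false

  leftOf-own : ∀ s k i → leftOf s k (s , i) ≡ does (toℕ i ≤? k)
  leftOf-own vSide k i = refl
  leftOf-own uSide k i = refl

  -- A contracted edge i → i+1 is not the kept edge k → k+1, so i ≠ k.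
  notCrossing : ∀ {s k} {i j : Fin (suc m)} → KeptAt s k →
                (q : T (toℕ j ≡ᵇ suc (toℕ i))) → keep (pathE s i j q) ≡ false →
                does (toℕ i ≤? k) ≡ does (toℕ j ≤? k)
  notCrossing {s} {k} {i} {j} (k<m , kept) q contracted =
    trans (≤?-step i≢k) (cong (λ t → does (t ≤? k)) (sym (≡ᵇ⇒≡ (toℕ j) _ q)))
    where
    i≢k : toℕ i ≢ k
    i≢k i≡k = subst T (trans (cong keep (sym (pathE-at {s} {i} {j} {k<m = k<m} q i≡k))) contracted) kept

  leftOf-respects : ∀ {s k} → KeptAt s k →
                    ∀ {x y} → ContractStep keep x y → leftOf s k x ≡ leftOf s k y
  leftOf-respects kept (rungE _ _ _ , () , _ , _)
  leftOf-respects {vSide} kept (pathE vSide i j q , _ , contracted , refl) =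
    notCrossing {j = j} kept q contracted
  leftOf-respects {uSide} kept (pathE uSide i j q , _ , contracted , refl) =
    notCrossing {j = j} kept q contracted
  leftOf-respects {vSide} kept (pathE uSide i j q , _ , _ , refl) = refl
  leftOf-respects {uSide} kept (pathE vSide i j q , _ , _ , refl) = refl

  keptEdge-separates : ∀ {s k a b} → KeptAt s k →
                       a ≤ k → k < b → b ≤ m → F s a ≢ F s b
  keptEdge-separates {s} {k} {a} {b} kept a≤k k<b b≤m Fa≡Fb = true≢false (begin
    true                     ≡⟨ dec-true (toℕ (pos a) ≤? k) (subst (_≤ k) (sym (toℕ-pos a≤m)) a≤k) ⟨
    does (toℕ (pos a) ≤? k)  ≡⟨ leftOf-own s k (pos a) ⟨
    leftOf s k (s , pos a)   ≡⟨ gfold isEquivalence (leftOf s k) (leftOf-respects kept) (class-f _ _ Fa≡Fb) ⟩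
    leftOf s k (s , pos b)   ≡⟨ leftOf-own s k (pos b) ⟩
    does (toℕ (pos b) ≤? k)  ≡⟨ dec-false (toℕ (pos b) ≤? k) (λ b≤k → <-irrefl refl (<-≤-trans k<b (subst (_≤ k) (toℕ-pos b≤m) b≤k))) ⟩
    false                    ∎)
    where
    open ≡-Reasoning
    a≤m : a ≤ m
    a≤m = ≤-trans a≤k (<⇒≤ (<-≤-trans k<b b≤m))
    true≢false : true ≢ false
    true≢false ()

  interval : ∀ {s a t b} → a ≤ t → t ≤ b → b ≤ m → F s a ≡ F s b → F s t ≡ F s a
  interval {s} {a} {t} a≤t t≤b b≤m Fa≡Fb with F s t ≟ F s a
  ... | yes Ft≡Fa = Ft≡Fa
  ... | no Ft≢Fa with changeStep _≟_ (F s) a≤t (Ft≢Fa ∘ sym)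
  ...   | k , a≤k , k<t , step = ⊥-elim (keptEdge-separates
            (edgeAt-kept (<-≤-trans k<t (≤-trans t≤b b≤m)) step)
            a≤k (<-≤-trans k<t t≤b) b≤m Fa≡Fb)

  bigBetweenTerminals : ∀ {s p q r a b b′} →
    F s 0 ≡ smallV b → F s m ≡ smallV b′ →
    F s p ≡ smallV b → F s q ≡ bigV a → F s r ≡ smallV b′ →
    p ≤ m → q ≤ m → p < q × q < r
  bigBetweenTerminals {s} {p} {q} {r} F0 Fm Fp Fq Fr p≤m q≤m = p<q , q<r
    where
    p<q : p < q
    p<q with q ≤? p
    ... | no q≰p = ≰⇒> q≰p
    ... | yes q≤p = ⊥-elim (big≢small Fq (trans (interval z≤n q≤p p≤m (trans F0 (sym Fp))) F0))
    q<r : q < r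
    q<r with r ≤? q
    ... | no r≰q = ≰⇒> r≰q
    ... | yes r≤q = ⊥-elim (big≢small Fq (trans (interval r≤q q≤m ≤-refl (trans Fr (sym Fm))) Fr))

  bigColourOn : (s : Side) → F s 0 ≢ F s m → ∃₂ λ a i → f (s , i) ≡ bigV a
  bigColourOn s F0≢Fm with changeStep _≟_ (F s) z≤n F0≢Fm
  ... | k , _ , k<m , step with K24-bigEnd (φ-inc (edgeAt s k k<m) (proj₂ (edgeAt-kept k<m step)))
  ...   | inj₁ (a , big) = a , pos k , big
  ...   | inj₂ (a , big) = a , pos (suc k) , big

  record RungBetween (c c′ : Fin 6) : Set where
    field
      uPos vPos : ℕ
      uPos≤m    : uPos ≤ m
      vPos≤m    : vPos ≤ m
      uColour   : F uSide uPos ≡ c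
      vColour   : F vSide vPos ≡ c′
      sameDepth : depth m uPos ≡ depth m vPos
  open RungBetween

  -- A K_{2,4}-edge joining a colour c of the u-path to a colour c′ of the
  -- v-path is the image of a rung: a path edge stays on one path.
  rungBetween : ∀ {c c′ i₀ j₀} → f (uSide , i₀) ≡ c → f (vSide , j₀) ≡ c′ →
                (e : K24Edge) → K24Incident c c′ e → RungBetween c c′
  rungBetween {c} {c′} {i₀} {j₀} c-on-u c′-on-v e c-e-c′ with φ-surj e
  ... | g , k , φg≡e = fromEdge g (subst (K24Incident _ _) φg≡e (φ-inc g k))
    where
    u≢v : uSide ≢ vSide
    u≢v ()
    onU : ∀ {x} → f x ≡ c → proj₁ x ≡ uSide
    onU fx≡c = sameSide (trans fx≡c (sym c-on-u))
    onV : ∀ {x} → f x ≡ c′ → proj₁ x ≡ vSide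
    onV fx≡c′ = sameSide (trans fx≡c′ (sym c′-on-v))
    fromEdge : (g : GEdge (suc m)) →
               K24Incident (f (proj₁ (ends g))) (f (proj₂ (ends g))) e → RungBetween c c′
    fromEdge g g-e with K24-ends g-e c-e-c′
    fromEdge (pathE s i j _) _ | inj₁ (x≡c , y≡c′) = ⊥-elim (u≢v (trans (sym (onU x≡c)) (onV y≡c′)))
    fromEdge (pathE s i j _) _ | inj₂ (x≡c′ , y≡c) = ⊥-elim (u≢v (trans (sym (onU y≡c)) (onV x≡c′)))
    fromEdge (rungE i j _) _   | inj₂ (x≡c′ , _)   = ⊥-elim (u≢v (onV x≡c′))
    fromEdge (rungE i j r) _   | inj₁ (x≡c , y≡c′) = record
      { uPos = toℕ i ; vPos = toℕ j
      ; uPos≤m = toℕ≤pred[n] i ; vPos≤m = toℕ≤pred[n] j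
      ; uColour = trans (cong (λ i′ → f (uSide , i′)) (pos-toℕ i)) x≡c
      ; vColour = trans (cong (λ j′ → f (vSide , j′)) (pos-toℕ j)) y≡c′
      ; sameDepth = rung-depth i j r
      }

  atLast : ∀ {s c} → f (s , fromℕ m) ≡ c → F s m ≡ c
  atLast {s} = trans (cong (λ i → f (s , i)) pos-last)

  -- Rungs realising Y–[v₁], Y–[vₙ], [u₁]–X, [uₙ]–X nest impossibly.
  absurd : ⊥
  absurd with terminals
  ... | (b₁ , v₁) , (b₂ , vₙ) , (b₃ , u₁) , (b₄ , uₙ) , v₁≢vₙ , _ , _ , _ , _ , u₁≢uₙ
    with bigColourOn uSide (λ e → u₁≢uₙ (trans e (atLast refl)))
       | bigColourOn vSide (λ e → v₁≢vₙ (trans e (atLast refl)))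
  ... | Y , _ , Y-on-u | X , _ , X-on-v = nestedRungs-impossible
    (sameDepth R₁) (sameDepth R₂) (sameDepth R₃) (sameDepth R₄)
    (uInside R₁) (uInside R₂) (uPos≤m R₄) (vInside R₃) (vInside R₄) (vPos≤m R₂)
    where
    R₁ : RungBetween (bigV Y) (smallV b₁)
    R₁ = rungBetween Y-on-u v₁ (Y , b₁) (inj₁ (refl , refl))
    R₂ : RungBetween (bigV Y) (smallV b₂)
    R₂ = rungBetween Y-on-u vₙ (Y , b₂) (inj₁ (refl , refl))
    R₃ : RungBetween (smallV b₃) (bigV X)
    R₃ = rungBetween u₁ X-on-v (X , b₃) (inj₂ (refl , refl))
    R₄ : RungBetween (smallV b₄) (bigV X)
    R₄ = rungBetween uₙ X-on-v (X , b₄) (inj₂ (refl , refl))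
    uInside : ∀ {c′} (R : RungBetween (bigV Y) c′) → uPos R₃ < uPos R × uPos R < uPos R₄
    uInside R = bigBetweenTerminals u₁ (atLast uₙ)
      (uColour R₃) (uColour R) (uColour R₄) (uPos≤m R₃) (uPos≤m R)
    vInside : ∀ {c} (R : RungBetween c (bigV X)) → vPos R₁ < vPos R × vPos R < vPos R₂
    vInside R = bigBetweenTerminals v₁ (atLast vₙ)
      (vColour R₁) (vColour R) (vColour R₂) (vPos≤m R₁) (vPos≤m R)

-- For n = 0 there are no terminals to place.
lemma2p3 : (n : ℕ) → ¬ XXLinkageMinor n
lemma2p3 zero    M = XXLinkageMinor.terminals M
lemma2p3 (suc m) M = XXMinor.absurd m M
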